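{- Let $G=(V,E)$ be a connected undirected graph with positive resistances $r$, let $T$ be a spanning tree of $G$, let $\mathbf{p}\in\mathbb{R}^V$, and let $\mathbf{b}\in\mathbb{R}^V$ with $\mathbbm{1}^\top\mathbf{b}=0$. Let $\mathbf{f}_T$ be the tree-defined flow with respect to $T$, $\mathbf{p}$, $\mathbf{b}$. Then $$\mathrm{gap}(\mathbf{f}_T,\mathbf{p})=\sum_{(i,j)\in T} r(i,j)\,\frac{\Delta(C(i,j))^2}{R(C(i,j))^2}.$$
   Context: Fix an orientation $\vec E$ of the edges. A $\mathbf{b}$-flow $\mathbf{f}\in\mathbb{R}^{\vec E}$ satisfies $\sum_{j:(i,j)\in\vec E}f(i,j)-\sum_{j:(j,i)\in\vec E}f(j,i)=b(i)$ for all $i$; its energy is $\mathcal{E}(\mathbf{f})=\sum_e r(e)f(e)^2$. With $\mathbf{L}=\sum_{ij\in E}\frac{1}{r(i,j)}(\mathbf{e}_i-\mathbf{e}_j)(\mathbf{e}_i-\mathbf{e}_j)^\top$ and $\mathcal{B}(\mathbf{p})=2\mathbf{b}^\top\mathbf{p}-\mathbf{p}^\top\mathbf{L}\mathbf{p}$, define $\mathrm{gap}(\mathbf{f},\mathbf{p})=\mathcal{E}(\mathbf{f})-\mathcal{B}(\mathbf{p})$. For a tree edge $(i,j)\in T$, $C(i,j)$ is the vertex set of the component of $T-ij$ containing $i$. For $C\subset V$: $\delta(C)$ is the set of edges with exactly one endpoint in $C$, $S(C)=\sum_{v\in C}b(v)$, $R(C)=\big(\sum_{kl\in\delta(C)}1/r(k,l)\big)^{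 -1}$, $f(C)=\sum_{kl\in E,\,k\in C,\,l\notin C}\frac{p(k)-p(l)}{r(k,l)}$, and $\Delta(C)=(S(C)-f(C))R(C)$. The tree-defined flow $\mathbf{f}_T$ is given by $f_T(i,j)=\frac{p(i)-p(j)}{r(i,j)}$ for $(i,j)\notin T$, and for $(i,j)\in T$, $f_T(i,j)=S(C(i,j))-\sum_{kl\in E-ij,\,k\in C(i,j),\,l\notin C(i,j)}\frac{p(k)-p(l)}{r(k,l)}$, so that $\mathbf{f}_T$ is a $\mathbf{b}$-flow. -}

module Defs where

open import Level using (Level; _⊔_) renaming (suc to lsuc)
open import Data.Nat using (ℕ; zero; suc)
open import Data.Fin using (Fin; zero; suc)
open import Data.Bool using (Bool; true; false; if_then_else_; _xor_; not; _∧_)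
open import Data.Product using (_×_; _,_)
open import Relation.Binary.Core using (Rel)
open import Relation.Binary.Structures using (IsStrictTotalOrder)
open import Relation.Binary.PropositionalEquality using (_≡_; _≢_)
open import Relation.Nullary using (¬_; yes; no)
open import Relation.Nullary.Decidable using (⌊_⌋)
open import Data.Sum using (_⊎_)
open import Data.Fin using (_≟_)
open import Algebra.Structures using (IsCommutativeRing)
open import Function.Bundles using (_⇔_)

-- An ordered field (abstract stand-in for ℝ).  The real numbers are an
-- instance (with the usual convention 0⁻¹ := 0, the value being irrelevant).

record OrderedField (c ℓ : Level) : Set (lsuc (c ⊔ ℓ)) where
  infixl 7 _*_
  infixl 6 _+_ _-_
  infix  4 _≈_ _<_
  infix  8 _⁻¹
  infixl 7 _/_
  infix  9 _²
  field
    Carrier : Set c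
    _≈_     : Rel Carrier ℓ
    _+_ _*_ : Carrier → Carrier → Carrier
    -_      : Carrier → Carrier
    0# 1#   : Carrier
    isCommutativeRing : IsCommutativeRing _≈_ _+_ _*_ -_ 0# 1#
    _<_     : Rel Carrier ℓ
    isStrictTotalOrder : IsStrictTotalOrder _≈_ _<_
    +-monoˡ-< : ∀ {x y} z → x < y → x + z < y + z
    *-pos     : ∀ {x y} → 0# < x → 0# < y → 0# < x * y
    0<1       : 0# < 1#
    _⁻¹       : Carrier → Carrier
    ⁻¹-inverseʳ : ∀ {x} → ¬ (x ≈ 0#) → x * x ⁻¹ ≈ 1#

  _-_ : Carrier → Carrier → Carrier
  x - y = x + (- y)

  _/_ : Carrier → Carrier → Carrier
  x / y = x * y ⁻¹

  2# : Carrier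
  2# = 1# + 1#

  _² : Carrier → Carrier
  x ² = x * x

  Σ : ∀ {k} → (Fin k → Carrier) → Carrier
  Σ {zero}  f = 0#
  Σ {suc k} f = f zero + Σ (λ i → f (suc i))

  [_]·_ : Bool → Carrier → Carrier
  [ true  ]· x = x
  [ false ]· x = 0#

  δ : ∀ {k} → Fin k → Fin k → Carrier
  δ i j with i ≟ j
  ... | yes _ = 1#
  ... | no  _ = 0#

-- Graphs with n vertices and m oriented edges (the orientation E⃗ is
-- fixed by tail/head), resistances r.

record Graph (n m : ℕ) : Set where
  field
    tail head : Fin m → Fin n

EdgeSet : ℕ → Set
EdgeSet m = Fin m → Bool

VSet : ℕ → Set
VSet n = Fin n → Bool

module _ {n m : ℕ} (G : Graph n m) where
  open Graph G

  data Reach (S : EdgeSet m) (u : Fin n) : Fin n → Set where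
    here : Reach S u u
    fwd  : (e : Fin m) → S e ≡ true → Reach S u (tail e) → Reach S u (head e)
    bwd  : (e : Fin m) → S e ≡ true → Reach S u (head e) → Reach S u (tail e)

  AllEdges : EdgeSet m
  AllEdges _ = true

  _－_ : EdgeSet m → Fin m → EdgeSet m
  (S － e) e' with e ≟ e'
  ... | yes _ = false
  ... | no  _ = S e'

  Simple : Set
  Simple = (∀ e → tail e ≢ head e)
         × (∀ e e' → e ≢ e' → ¬ ((tail e ≡ tail e' × head e ≡ head e')
                                 ⊎ (tail e ≡ head e' × head e ≡ tail e')))

  Connected : EdgeSet m → Set
  Connected S = ∀ u v → Reach S u v

  -- T is a spanning tree: spanning connected subgraph, acyclic
  -- (acyclic expressed as: no edge of T lies on a cycle of T, i.e. the
  -- endpoints of each tree edge are disconnected in T - e)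
  SpanningTree : EdgeSet m → Set
  SpanningTree T = Connected T
                 × (∀ e → T e ≡ true → ¬ Reach (T － e) (tail e) (head e))

  -- C is the family of vertex sets C(i,j): for every tree edge e = (i,j),
  -- C e is the vertex set of the component of T - ij containing i.
  IsComponentFamily : EdgeSet m → (Fin m → VSet n) → Set
  IsComponentFamily T C =
    ∀ e → T e ≡ true → ∀ v → (C e v ≡ true) ⇔ Reach (T － e) (tail e) v

module Electrical {c ℓ} (F : OrderedField c ℓ) {n m : ℕ} (G : Graph n m)
                  (r : Fin m → OrderedField.Carrier F) where
  open OrderedField F
  open Graph G

  IsBFlow : (Fin n → Carrier) → (Fin m → Carrier) → Set ℓ
  IsBFlow b f = ∀ i → Σ (λ e → [ tail e =ᵇ i ]· f e) - Σ (λ e → [ head e =ᵇ i ]· f e) ≈ b i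
    where
    _=ᵇ_ : Fin n → Fin n → Bool
    x =ᵇ y = ⌊ x ≟ y ⌋

  energy : (Fin m → Carrier) → Carrier
  energy f = Σ (λ e → r e * (f e) ²)

  -- Laplacian L = Σ_{ij∈E} (1/r(i,j)) (e_i - e_j)(e_i - e_j)ᵀ, entrywise
  L : Fin n → Fin n → Carrier
  L u v = Σ (λ e → (1# / r e) * ((δ u (tail e) - δ u (head e)) * (δ v (tail e) - δ v (head e))))

  B : (Fin n → Carrier) → (Fin n → Carrier) → Carrier
  B b p = 2# * Σ (λ i → b i * p i) - Σ (λ u → Σ (λ v → p u * L u v * p v))

  gap : (Fin n → Carrier) → (Fin m → Carrier) → (Fin n → Carrier) → Carrier
  gap b f p = energy f - B b p

  S : (Fin n → Carrier) → VSet n → Carrier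
  S b C = Σ (λ v → [ C v ]· b v)

  crosses : VSet n → Fin m → Bool
  crosses C e = C (tail e) xor C (head e)

  R : VSet n → Carrier
  R C = (Σ (λ e → [ crosses C e ]· (1# / r e))) ⁻¹

  outflow : (Fin n → Carrier) → VSet n → Fin m → Carrier
  outflow p C e with C (tail e) | C (head e)
  ... | true  | false = (p (tail e) - p (head e)) / r e
  ... | false | true  = (p (head e) - p (tail e)) / r e
  ... | _     | _     = 0#

  fC : (Fin n → Carrier) → VSet n → Carrier
  fC p C = Σ (λ e → outflow p C e)

  Δ : (Fin n → Carrier) → (Fin n → Carrier) → VSet n → Carrier
  Δ b p C = (S b C - fC p C) * R C

  treeFlow : (T : EdgeSet m) (C : Fin m → VSet n)
             (p b : Fin n → Carrier) → Fin m → Carrier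
  treeFlow T C p b e with T e
  ... | false = (p (tail e) - p (head e)) / r e
  ... | true  = S b (C e) - Σ (λ e' → [ not (e =ᵉ e') ]· outflow p (C e) e')
    where
    _=ᵉ_ : Fin m → Fin m → Bool
    x =ᵉ y = ⌊ x ≟ y ⌋

-- Split the tree-defined flow as f_T = g + h, where g e = (p(tail e) - p(head e)) / r e is the
-- flow induced by the potentials p and h e = S(C e) - f(C e) = Δ(C e) / R(C e) on tree edges,
-- 0 elsewhere.  Expanding the energy with r g = (potential drop) gives
--   E(f_T) = pᵀLp + 2 Σ_e drop(e) h(e) + Σ_e r(e) h(e)².
-- The cross term is computed through the potential φ(v) = Σ_{e ∈ T, v ∈ C e} drop(e): across a
-- tree edge e₀ only C e₀ separates the endpoints, so φ has the same drops as p along T and, T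
-- being spanning, differs from p by a constant.  Exchanging summations then gives
--   Σ_e drop(e) h(e) = bᵀφ - Σ_e g(e) (φ(tail e) - φ(head e)) = bᵀp - pᵀLp,
-- using 1ᵀb = 0, and the gap E(f_T) - 2bᵀp + pᵀLp collapses to Σ_e r(e) h(e)².
module Submission where

open import Defs
open import Level using (Level)
open import Data.Nat as ℕ using (ℕ; zero; suc)
open import Data.Nat.Properties using (+-suc)
open import Data.Integer as ℤ using (ℤ; +_; -[1+_])
open import Data.Integer.Properties using ([1+m]⊖[1+n]≡m⊖n)
import Data.Sign as Sign
import Data.Maybe as Maybe
open import Data.Fin using (Fin; zero; suc; _≟_)
open import Data.Fin.Properties using (suc-injective)
open import Data.Bool using (Bool; true; false; not; _xor_)
open import Data.Sum using (inj₁; inj₂)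
open import Data.Product using (proj₁; proj₂)
open import Data.Empty using (⊥-elim)
open import Function using (_∘_)
open import Function.Bundles using (Equivalence)
open import Relation.Nullary using (yes; no; ¬_)
open import Relation.Nullary.Decidable using (⌊_⌋; dec⇒maybe)
open import Relation.Binary.PropositionalEquality as ≡ using (_≡_; _≢_)
open import Relation.Binary.Structures using (IsStrictTotalOrder)
open import Relation.Binary.Definitions using (tri<; tri≈; tri>)
open import Algebra.Bundles using (CommutativeRing)
open import Algebra.Structures using (IsCommutativeRing)
open import Algebra.Solver.Ring.AlmostCommutativeRing
  using (fromCommutativeRing; _-Raw-AlmostCommutative⟶_)

true⇔true⇒≡ : ∀ {x y : Bool} → (x ≡ true → y ≡ true) → (y ≡ true → x ≡ true) → x ≡ y
true⇔true⇒≡ {false} {false} _   _   = ≡.refl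
true⇔true⇒≡ {false} {true}  _   y⇒x = y⇒x ≡.refl
true⇔true⇒≡ {true}  {false} x⇒y _   = ≡.sym (x⇒y ≡.refl)
true⇔true⇒≡ {true}  {true}  _   _   = ≡.refl

-- The ring solver needs coefficients whose arithmetic computes; with coefficients taken in the
-- ring itself, 1# + 1# or x - x would never normalise.  Integers map into every commutative ring.
module IntegerCoefficientSolver {c ℓ} (R : CommutativeRing c ℓ) where
  open CommutativeRing R
  open import Algebra.Properties.Ring ring
    using (-0#≈0#; -‿involutive; -‿distribˡ-*; -‿distribʳ-*; -‿+-comm)
  open import Algebra.Properties.Semiring.Mult.TCOptimised semiring
    using (_×_; 1+×; ×-homo-+; ×1-homo-*)
  open import Relation.Binary.Reasoning.Setoid setoid

  fromℤ : ℤ → Carrier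
  fromℤ (+ n)    = n × 1#
  fromℤ -[1+ n ] = - (suc n × 1#)

  ⊖-homo : ∀ m n → fromℤ (m ℤ.⊖ n) ≈ m × 1# - n × 1#
  ⊖-homo m       zero    = trans (sym (+-identityʳ _)) (+-congˡ (sym -0#≈0#))
  ⊖-homo zero    (suc n) = sym (+-identityˡ _)
  ⊖-homo (suc m) (suc n) = begin
    fromℤ (suc m ℤ.⊖ suc n)        ≡⟨ ≡.cong fromℤ ([1+m]⊖[1+n]≡m⊖n m n) ⟩
    fromℤ (m ℤ.⊖ n)                ≈⟨ ⊖-homo m n ⟩
    m × 1# - n × 1#                ≈⟨ cancel 1# (m × 1#) (n × 1#) ⟨
    (1# + m × 1#) - (1# + n × 1#)  ≈⟨ +-cong (1+× m 1#) (-‿cong (1+× n 1#)) ⟨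
    suc m × 1# - suc n × 1#        ∎
    where
    cancel : ∀ a x y → (a + x) - (a + y) ≈ x - y
    cancel a x y = begin
      (a + x) - (a + y)    ≈⟨ +-cong (+-comm a x) (sym (-‿+-comm a y)) ⟩
      (x + a) + (- a - y)  ≈⟨ +-assoc x a _ ⟩
      x + (a + (- a - y))  ≈⟨ +-congˡ (+-assoc a (- a) (- y)) ⟨
      x + ((a - a) - y)    ≈⟨ +-congˡ (+-congʳ (-‿inverseʳ a)) ⟩
      x + (0# - y)         ≈⟨ +-congˡ (+-identityˡ (- y)) ⟩
      x - y                ∎

  +-homo : ∀ i j → fromℤ (i ℤ.+ j) ≈ fromℤ i + fromℤ j
  +-homo (+ m)    (+ n)    = ×-homo-+ 1# m n
  +-homo (+ m)    -[1+ n ] = ⊖-homo m (suc n)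
  +-homo -[1+ m ] (+ n)    = trans (⊖-homo n (suc m)) (+-comm _ _)
  +-homo -[1+ m ] -[1+ n ] = begin
    - (suc (suc (m ℕ.+ n)) × 1#)     ≡⟨ ≡.cong (λ k → - (suc k × 1#)) (≡.sym (+-suc m n)) ⟩
    - ((suc m ℕ.+ suc n) × 1#)       ≈⟨ -‿cong (×-homo-+ 1# (suc m) (suc n)) ⟩
    - (suc m × 1# + suc n × 1#)      ≈⟨ -‿+-comm _ _ ⟨
    - (suc m × 1#) + - (suc n × 1#)  ∎

  +◃-homo : ∀ k → fromℤ (Sign.+ ℤ.◃ k) ≈ k × 1#
  +◃-homo zero    = refl
  +◃-homo (suc k) = refl

  -◃-homo : ∀ k → fromℤ (Sign.- ℤ.◃ k) ≈ - (k × 1#)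
  -◃-homo zero    = sym -0#≈0#
  -◃-homo (suc k) = refl

  *-homo : ∀ i j → fromℤ (i ℤ.* j) ≈ fromℤ i * fromℤ j
  *-homo (+ m)    (+ n)    = trans (+◃-homo (m ℕ.* n)) (×1-homo-* m n)
  *-homo (+ m)    -[1+ n ] =
    trans (-◃-homo (m ℕ.* suc n)) (trans (-‿cong (×1-homo-* m (suc n))) (-‿distribʳ-* _ _))
  *-homo -[1+ m ] (+ n)    =
    trans (-◃-homo (suc m ℕ.* n)) (trans (-‿cong (×1-homo-* (suc m) n)) (-‿distribˡ-* _ _))
  *-homo -[1+ m ] -[1+ n ] = begin
    fromℤ (Sign.+ ℤ.◃ (suc m ℕ.* suc n))  ≈⟨ +◃-homo (suc m ℕ.* suc n) ⟩
    (suc m ℕ.* suc n) × 1#                ≈⟨ ×1-homo-* (suc m) (suc n) ⟩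
    suc m × 1# * suc n × 1#               ≈⟨ -‿involutive _ ⟨
    - - (suc m × 1# * suc n × 1#)         ≈⟨ -‿cong (-‿distribˡ-* _ _) ⟩
    - (- (suc m × 1#) * suc n × 1#)       ≈⟨ -‿distribʳ-* _ _ ⟩
    - (suc m × 1#) * - (suc n × 1#)       ∎

  -‿homo : ∀ i → fromℤ (ℤ.- i) ≈ - fromℤ i
  -‿homo (+ zero)  = sym -0#≈0#
  -‿homo (+ suc n) = refl
  -‿homo -[1+ n ]  = sym (-‿involutive _)

  homomorphism : ℤ.+-*-rawRing -Raw-AlmostCommutative⟶ fromCommutativeRing R
  homomorphism = record
    { ⟦_⟧ = fromℤ ; +-homo = +-homo ; *-homo = *-homo ; -‿homo = -‿homo
    ; 0-homo = refl ; 1-homo = refl }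

  open import Algebra.Solver.Ring ℤ.+-*-rawRing (fromCommutativeRing R) homomorphism
    (λ i j → Maybe.map (reflexive ∘ ≡.cong fromℤ) (dec⇒maybe (i ℤ.≟ j)))
    public using (solve; _:=_; _:+_; _:-_; _:*_; con)

module OrderedFieldProperties {c ℓ} (F : OrderedField c ℓ) where
  open OrderedField F
  open IsCommutativeRing isCommutativeRing public hiding (zero; _-_)
  open IsStrictTotalOrder isStrictTotalOrder
    using (compare; irrefl; <-resp-≈) renaming (trans to <-trans)

  commutativeRing : CommutativeRing c ℓ
  commutativeRing = record { isCommutativeRing = isCommutativeRing }

  open CommutativeRing commutativeRing using (ring; semiring)
  open import Algebra.Properties.Ring ring using (-0#≈0#; -‿+-comm; -‿distribʳ-*)
  open import Algebra.Properties.Semiring.Sum semiring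
    using (sum; sum-cong-≋; sum-replicate-zero; ∑-distrib-+; *-distribˡ-sum; *-distribʳ-sum)
  open IntegerCoefficientSolver commutativeRing public
    using (solve; _:=_; _:+_; _:-_; _:*_; con)
  open import Relation.Binary.Reasoning.Setoid setoid public
  open import Relation.Binary.Construct.StrictToNonStrict _≈_ _<_ using (_≤_)

  Σ≡sum : ∀ {k} (f : Fin k → Carrier) → Σ f ≡ sum f
  Σ≡sum {zero}  f = ≡.refl
  Σ≡sum {suc k} f = ≡.cong (_+_ (f zero)) (Σ≡sum (f ∘ suc))

  Σ-cong : ∀ {k} {f g : Fin k → Carrier} → (∀ i → f i ≈ g i) → Σ f ≈ Σ g
  Σ-cong {f = f} {g} f≈g rewrite Σ≡sum f | Σ≡sum g = sum-cong-≋ f≈g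

  Σ-zero : ∀ {k} {f : Fin k → Carrier} → (∀ i → f i ≈ 0#) → Σ f ≈ 0#
  Σ-zero {k} f≈0 = trans (Σ-cong f≈0) (trans (reflexive (Σ≡sum {k} _)) (sum-replicate-zero k))

  Σ-distrib-+ : ∀ {k} (f g : Fin k → Carrier) → Σ (λ i → f i + g i) ≈ Σ f + Σ g
  Σ-distrib-+ f g rewrite Σ≡sum f | Σ≡sum g | Σ≡sum (λ i → f i + g i) = ∑-distrib-+ f g

  *-distribˡ-Σ : ∀ {k} x (f : Fin k → Carrier) → x * Σ f ≈ Σ (λ i → x * f i)
  *-distribˡ-Σ x f rewrite Σ≡sum f | Σ≡sum (λ i → x * f i) = *-distribˡ-sum x f

  *-distribʳ-Σ : ∀ {k} x (f : Fin k → Carrier) → Σ f * x ≈ Σ (λ i → f i * x)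
  *-distribʳ-Σ x f rewrite Σ≡sum f | Σ≡sum (λ i → f i * x) = *-distribʳ-sum x f

  Σ-distrib-neg : ∀ {k} (f : Fin k → Carrier) → Σ (λ i → - f i) ≈ - Σ f
  Σ-distrib-neg {zero}  f = sym -0#≈0#
  Σ-distrib-neg {suc k} f = trans (+-congˡ (Σ-distrib-neg (f ∘ suc))) (-‿+-comm _ _)

  Σ-distrib-- : ∀ {k} (f g : Fin k → Carrier) → Σ (λ i → f i - g i) ≈ Σ f - Σ g
  Σ-distrib-- f g = trans (Σ-distrib-+ f (λ i → - g i)) (+-congˡ (Σ-distrib-neg g))

  Σ-comm : ∀ {k l} (f : Fin k → Fin l → Carrier) →
           Σ (λ i → Σ (λ j → f i j)) ≈ Σ (λ j → Σ (λ i → f i j))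
  Σ-comm {zero}  {l} f = sym (Σ-zero {l} (λ _ → refl))
  Σ-comm {suc k}     f = begin
    Σ (f zero) + Σ (λ i → Σ (f (suc i)))
      ≈⟨ +-congˡ (Σ-comm (f ∘ suc)) ⟩
    Σ (f zero) + Σ (λ j → Σ (λ i → f (suc i) j))
      ≈⟨ Σ-distrib-+ (f zero) (λ j → Σ (λ i → f (suc i) j)) ⟨
    Σ (λ j → Σ (λ i → f i j)) ∎

  Σ-product : ∀ {k l} (f : Fin k → Carrier) (g : Fin l → Carrier) →
              Σ (λ i → Σ (λ j → f i * g j)) ≈ Σ f * Σ g
  Σ-product f g = begin
    Σ (λ i → Σ (λ j → f i * g j))  ≈⟨ Σ-cong (λ i → *-distribˡ-Σ (f i) g) ⟨
    Σ (λ i → f i * Σ g)            ≈⟨ *-distribʳ-Σ (Σ g) f ⟨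
    Σ f * Σ g                      ∎

  Σ-concentrated : ∀ {k} (f : Fin k → Carrier) i → (∀ j → j ≢ i → f j ≈ 0#) → Σ f ≈ f i
  Σ-concentrated {suc k} f zero    f≈0 =
    trans (+-congˡ (Σ-zero (λ j → f≈0 (suc j) λ ()))) (+-identityʳ _)
  Σ-concentrated {suc k} f (suc i) f≈0 =
    trans (+-cong (f≈0 zero λ ()) (Σ-concentrated (f ∘ suc) i f∘suc≈0)) (+-identityˡ _)
    where
    f∘suc≈0 : ∀ j → j ≢ i → f (suc j) ≈ 0#
    f∘suc≈0 j j≢i = f≈0 (suc j) (j≢i ∘ suc-injective)

  Σ-split : ∀ {k} (f : Fin k → Carrier) i → Σ f ≈ Σ (λ j → [ not ⌊ i ≟ j ⌋ ]· f j) + f i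
  Σ-split {k} f i = begin
    Σ f                    ≈⟨ Σ-cong split ⟩
    Σ (λ j → f≢ j + f≡ j)  ≈⟨ Σ-distrib-+ f≢ f≡ ⟩
    Σ f≢ + Σ f≡            ≈⟨ +-congˡ (Σ-concentrated f≡ i off-i) ⟩
    Σ f≢ + f≡ i            ≈⟨ +-congˡ at-i ⟩
    Σ f≢ + f i             ∎
    where
    f≢ f≡ : Fin k → Carrier
    f≢ j = [ not ⌊ i ≟ j ⌋ ]· f j
    f≡ j = [ ⌊ i ≟ j ⌋ ]· f j
    split : ∀ j → f j ≈ f≢ j + f≡ j
    split j with i ≟ j
    ... | yes _ = sym (+-identityˡ _)
    ... | no  _ = sym (+-identityʳ _)
    off-i : ∀ j → j ≢ i → f≡ j ≈ 0#
    off-i j j≢i with i ≟ j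
    ... | yes i≡j = ⊥-elim (j≢i (≡.sym i≡j))
    ... | no  _   = refl
    at-i : f≡ i ≈ f i
    at-i with i ≟ i
    ... | yes _   = refl
    ... | no  i≢i = ⊥-elim (i≢i ≡.refl)

  Σ-*δ : ∀ {k} (q : Fin k → Carrier) x → Σ (λ u → q u * δ u x) ≈ q x
  Σ-*δ q x = trans (Σ-concentrated _ x off-x) (trans (*-congˡ at-x) (*-identityʳ (q x)))
    where
    off-x : ∀ u → u ≢ x → q u * δ u x ≈ 0#
    off-x u u≢x with u ≟ x
    ... | yes u≡x = ⊥-elim (u≢x u≡x)
    ... | no  _   = zeroʳ (q u)
    at-x : δ x x ≈ 1#
    at-x with x ≟ x
    ... | yes _   = refl
    ... | no  x≢x = ⊥-elim (x≢x ≡.refl)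

  Σ-*-shift-invariant : ∀ {k} (b φ p : Fin k → Carrier) → Σ b ≈ 0# →
                        (∀ u v → φ u - φ v ≈ p u - p v) →
                        Σ (λ v → b v * φ v) ≈ Σ (λ v → b v * p v)
  Σ-*-shift-invariant {zero}  b φ p Σb≈0 φ∼p = refl
  Σ-*-shift-invariant {suc k} b φ p Σb≈0 φ∼p = begin
    Σ (λ v → b v * φ v)                           ≈⟨ Σ-cong (λ v → *-congˡ {b v} (shift v)) ⟩
    Σ (λ v → b v * (p v + offset))                ≈⟨ Σ-cong (λ v → distribˡ (b v) (p v) offset) ⟩
    Σ (λ v → b v * p v + b v * offset)            ≈⟨ Σ-distrib-+ (λ v → b v * p v) (λ v → b v * offset) ⟩
    Σ (λ v → b v * p v) + Σ (λ v → b v * offset)  ≈⟨ +-congˡ (*-distribʳ-Σ offset b) ⟨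
    Σ (λ v → b v * p v) + Σ b * offset            ≈⟨ +-congˡ (trans (*-congʳ Σb≈0) (zeroˡ offset)) ⟩
    Σ (λ v → b v * p v) + 0#                      ≈⟨ +-identityʳ _ ⟩
    Σ (λ v → b v * p v)                           ∎
    where
    offset : Carrier
    offset = φ zero - p zero
    shift : ∀ v → φ v ≈ p v + offset
    shift v = begin
      φ v                      ≈⟨ solve 2 (λ φv φ0 → φv := (φv :- φ0) :+ φ0) refl (φ v) (φ zero) ⟩
      (φ v - φ zero) + φ zero  ≈⟨ +-congʳ (φ∼p v zero) ⟩
      (p v - p zero) + φ zero  ≈⟨ solve 3 (λ pv φ0 p0 → (pv :- p0) :+ φ0 := pv :+ (φ0 :- p0))
                                          refl (p v) (φ zero) (p zero) ⟩
      p v + offset             ∎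

  difference-swap : ∀ {x y z w} → x - y ≈ z - w → x - z ≈ y - w
  difference-swap {x} {y} {z} {w} x-y≈z-w = begin
    x - z            ≈⟨ solve 3 (λ x y z → x :- z := (x :- y) :- z :+ y) refl x y z ⟩
    (x - y) - z + y  ≈⟨ +-congʳ (+-congʳ x-y≈z-w) ⟩
    (z - w) - z + y  ≈⟨ solve 3 (λ y z w → (z :- w) :- z :+ y := y :- w) refl y z w ⟩
    y - w            ∎

  𝟙 : Bool → Carrier
  𝟙 x = [ x ]· 1#

  []·≈𝟙* : ∀ x y → [ x ]· y ≈ 𝟙 x * y
  []·≈𝟙* true  y = sym (*-identityˡ y)
  []·≈𝟙* false y = sym (zeroˡ y)

  <-respʳ-≈ : ∀ {x y z} → y ≈ z → x < y → x < z
  <-respʳ-≈ = proj₁ <-resp-≈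

  <-respˡ-≈ : ∀ {x y z} → y ≈ z → y < x → z < x
  <-respˡ-≈ = proj₂ <-resp-≈

  ≥0-resp-≈ : ∀ {x y} → x ≈ y → 0# ≤ x → 0# ≤ y
  ≥0-resp-≈ x≈y (inj₁ 0<x) = inj₁ (<-respʳ-≈ x≈y 0<x)
  ≥0-resp-≈ x≈y (inj₂ 0≈x) = inj₂ (trans 0≈x x≈y)

  []·-nonneg : ∀ x {y} → 0# ≤ y → 0# ≤ [ x ]· y
  []·-nonneg true  0≤y = 0≤y
  []·-nonneg false 0≤y = inj₂ refl

  <⇒≉ : ∀ {x y} → x < y → ¬ x ≈ y
  <⇒≉ x<y x≈y = irrefl refl (<-respˡ-≈ x≈y x<y)

  x>0⇒x≉0 : ∀ {x} → 0# < x → ¬ x ≈ 0#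
  x>0⇒x≉0 0<x x≈0 = <⇒≉ 0<x (sym x≈0)

  x≉0⇒x⁻¹≉0 : ∀ {x} → ¬ x ≈ 0# → ¬ x ⁻¹ ≈ 0#
  x≉0⇒x⁻¹≉0 {x} x≉0 x⁻¹≈0 = x>0⇒x≉0 0<1 (begin
    1#        ≈⟨ ⁻¹-inverseʳ x≉0 ⟨
    x * x ⁻¹  ≈⟨ *-congˡ x⁻¹≈0 ⟩
    x * 0#    ≈⟨ zeroʳ x ⟩
    0#        ∎)

  x≉0⇒x²≉0 : ∀ {x} → ¬ x ≈ 0# → ¬ x ² ≈ 0#
  x≉0⇒x²≉0 {x} x≉0 x²≈0 = x≉0 (begin
    x               ≈⟨ *-identityʳ x ⟨
    x * 1#          ≈⟨ *-congˡ (⁻¹-inverseʳ x≉0) ⟨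
    x * (x * x ⁻¹)  ≈⟨ *-assoc x x (x ⁻¹) ⟨
    x ² * x ⁻¹      ≈⟨ *-congʳ x²≈0 ⟩
    0# * x ⁻¹       ≈⟨ zeroˡ (x ⁻¹) ⟩
    0#              ∎)

  x<0⇒-x>0 : ∀ {x} → x < 0# → 0# < - x
  x<0⇒-x>0 {x} x<0 =
    <-respʳ-≈ (+-identityˡ (- x)) (<-respˡ-≈ (-‿inverseʳ x) (+-monoˡ-< (- x) x<0))

  x>0⇒x⁻¹>0 : ∀ {x} → 0# < x → 0# < x ⁻¹
  x>0⇒x⁻¹>0 {x} 0<x with compare (x ⁻¹) 0#
  ... | tri> _ _ 0<x⁻¹ = 0<x⁻¹
  ... | tri≈ _ x⁻¹≈0 _ = ⊥-elim (x≉0⇒x⁻¹≉0 (x>0⇒x≉0 0<x) x⁻¹≈0)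
  ... | tri< x⁻¹<0 _ _ = ⊥-elim (irrefl refl (<-trans 0<1 1<0))
    where
    x*-x⁻¹≈-1 : x * - (x ⁻¹) ≈ - 1#
    x*-x⁻¹≈-1 = trans (sym (-‿distribʳ-* x (x ⁻¹))) (-‿cong (⁻¹-inverseʳ (x>0⇒x≉0 0<x)))
    0<-1 : 0# < - 1#
    0<-1 = <-respʳ-≈ x*-x⁻¹≈-1 (*-pos 0<x (x<0⇒-x>0 x⁻¹<0))
    1<0 : 1# < 0#
    1<0 = <-respʳ-≈ (-‿inverseˡ 1#) (<-respˡ-≈ (+-identityˡ 1#) (+-monoˡ-< 1# 0<-1))

  x>0∧y≥0⇒x+y>0 : ∀ {x y} → 0# < x → 0# ≤ y → 0# < x + y
  x>0∧y≥0⇒x+y>0 {x} {y} 0<x (inj₁ 0<y) = <-trans 0<y (<-respˡ-≈ (+-identityˡ y) (+-monoˡ-< y 0<x))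
  x>0∧y≥0⇒x+y>0 {x} {y} 0<x (inj₂ 0≈y) = <-respʳ-≈ (trans (sym (+-identityʳ x)) (+-congˡ 0≈y)) 0<x

  x≥0∧y≥0⇒x+y≥0 : ∀ {x y} → 0# ≤ x → 0# ≤ y → 0# ≤ x + y
  x≥0∧y≥0⇒x+y≥0         (inj₁ 0<x) 0≤y = inj₁ (x>0∧y≥0⇒x+y>0 0<x 0≤y)
  x≥0∧y≥0⇒x+y≥0 {x} {y} (inj₂ 0≈x) 0≤y =
    ≥0-resp-≈ (trans (sym (+-identityˡ y)) (+-congʳ 0≈x)) 0≤y

  Σ-nonneg : ∀ {k} (f : Fin k → Carrier) → (∀ i → 0# ≤ f i) → 0# ≤ Σ f
  Σ-nonneg {zero}  f f≥0 = inj₂ refl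
  Σ-nonneg {suc k} f f≥0 = x≥0∧y≥0⇒x+y≥0 (f≥0 zero) (Σ-nonneg (f ∘ suc) (f≥0 ∘ suc))

  Σ-pos : ∀ {k} (f : Fin k → Carrier) → (∀ i → 0# ≤ f i) → ∀ j → 0# < f j → 0# < Σ f
  Σ-pos {suc k} f f≥0 zero    0<fj = x>0∧y≥0⇒x+y>0 0<fj (Σ-nonneg (f ∘ suc) (f≥0 ∘ suc))
  Σ-pos {suc k} f f≥0 (suc j) 0<fj =
    <-respʳ-≈ (+-comm _ (f zero)) (x>0∧y≥0⇒x+y>0 (Σ-pos (f ∘ suc) (f≥0 ∘ suc) j 0<fj) (f≥0 zero))

  module Network {n m : ℕ} (G : Graph n m) (r : Fin m → Carrier) where
    open Graph G
    open Electrical F G r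

    Reach-invariant : ∀ {S} (ψ : Fin n → Carrier) →
                      (∀ e → S e ≡ true → ψ (tail e) ≈ ψ (head e)) →
                      ∀ {u v} → Reach G S u v → ψ u ≈ ψ v
    Reach-invariant ψ ψ-edge here               = refl
    Reach-invariant ψ ψ-edge (fwd e e∈S u⇝tail) =
      trans (Reach-invariant ψ ψ-edge u⇝tail) (ψ-edge e e∈S)
    Reach-invariant ψ ψ-edge (bwd e e∈S u⇝head) =
      trans (Reach-invariant ψ ψ-edge u⇝head) (sym (ψ-edge e e∈S))

    drop : (Fin n → Carrier) → Fin m → Carrier
    drop p e = p (tail e) - p (head e)

    potentialFlow : (Fin n → Carrier) → Fin m → Carrier
    potentialFlow p e = drop p e / r e

    potentialEnergy : (Fin n → Carrier) → Carrier
    potentialEnergy p = Σ (λ e → drop p e * potentialFlow p e)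

    r*potentialFlow≈drop : ∀ p e → ¬ r e ≈ 0# → r e * potentialFlow p e ≈ drop p e
    r*potentialFlow≈drop p e r≉0 = begin
      r e * (drop p e * r e ⁻¹)  ≈⟨ solve 3 (λ r d r⁻¹ → r :* (d :* r⁻¹) := d :* (r :* r⁻¹))
                                            refl (r e) (drop p e) (r e ⁻¹) ⟩
      drop p e * (r e * r e ⁻¹)  ≈⟨ *-congˡ (⁻¹-inverseʳ r≉0) ⟩
      drop p e * 1#              ≈⟨ *-identityʳ _ ⟩
      drop p e                   ∎

    Σ-*incidence : ∀ p e → Σ (λ u → p u * (δ u (tail e) - δ u (head e))) ≈ drop p e
    Σ-*incidence p e = begin
      Σ (λ u → p u * (δ u (tail e) - δ u (head e)))
        ≈⟨ Σ-cong (λ u → solve 3 (λ x y z → x :* (y :- z) := x :* y :- x :* z)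
                                 refl (p u) (δ u (tail e)) (δ u (head e))) ⟩
      Σ (λ u → p u * δ u (tail e) - p u * δ u (head e))
        ≈⟨ Σ-distrib-- (λ u → p u * δ u (tail e)) (λ u → p u * δ u (head e)) ⟩
      Σ (λ u → p u * δ u (tail e)) - Σ (λ u → p u * δ u (head e))
        ≈⟨ +-cong (Σ-*δ p (tail e)) (-‿cong (Σ-*δ p (head e))) ⟩
      drop p e ∎

    Laplacian-quadratic-form : ∀ p → Σ (λ u → Σ (λ v → p u * L u v * p v)) ≈ potentialEnergy p
    Laplacian-quadratic-form p = begin
      Σ (λ u → Σ (λ v → p u * L u v * p v))     ≈⟨ Σ-cong (λ u → Σ-cong (λ v → expand u v)) ⟩
      Σ (λ u → Σ (λ v → Σ (λ e → term e u v)))  ≈⟨ Σ-cong (λ u → Σ-comm (λ v e → term e u v)) ⟩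
      Σ (λ u → Σ (λ e → Σ (λ v → term e u v)))  ≈⟨ Σ-comm (λ u e → Σ (λ v → term e u v)) ⟩
      Σ (λ e → Σ (λ u → Σ (λ v → term e u v)))  ≈⟨ Σ-cong factor ⟩
      potentialEnergy p                          ∎
      where
      a : Fin n → Fin m → Carrier
      a u e = δ u (tail e) - δ u (head e)
      term : Fin m → Fin n → Fin n → Carrier
      term e u v = (1# / r e * (p u * a u e)) * (p v * a v e)
      expand : ∀ u v → p u * L u v * p v ≈ Σ (λ e → term e u v)
      expand u v = begin
        p u * L u v * p v
          ≈⟨ *-congʳ (*-distribˡ-Σ (p u) (λ e → 1# / r e * (a u e * a v e))) ⟩
        Σ (λ e → p u * (1# / r e * (a u e * a v e))) * p v
          ≈⟨ *-distribʳ-Σ (p v) (λ e → p u * (1# / r e * (a u e * a v e))) ⟩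
        Σ (λ e → p u * (1# / r e * (a u e * a v e)) * p v)
          ≈⟨ Σ-cong (λ e → solve 5 (λ pu w au av pv → pu :* (w :* (au :* av)) :* pv
                                                      := (w :* (pu :* au)) :* (pv :* av))
                                   refl (p u) (1# / r e) (a u e) (a v e) (p v)) ⟩
        Σ (λ e → term e u v) ∎
      factor : ∀ e → Σ (λ u → Σ (λ v → term e u v)) ≈ drop p e * potentialFlow p e
      factor e = begin
        Σ (λ u → Σ (λ v → term e u v))
          ≈⟨ Σ-product (λ u → 1# / r e * (p u * a u e)) (λ v → p v * a v e) ⟩
        Σ (λ u → 1# / r e * (p u * a u e)) * Σ (λ v → p v * a v e)
          ≈⟨ *-cong (trans (sym (*-distribˡ-Σ (1# / r e) (λ u → p u * a u e))) (*-congˡ (Σ-*incidence p e)))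
                    (Σ-*incidence p e) ⟩
        1# / r e * drop p e * drop p e
          ≈⟨ solve 2 (λ r⁻¹ d → con (+ 1) :* r⁻¹ :* d :* d := d :* (d :* r⁻¹))
                     refl (r e ⁻¹) (drop p e) ⟩
        drop p e * potentialFlow p e ∎

    energy-expansion : ∀ p (h f : Fin m → Carrier) → (∀ e → ¬ r e ≈ 0#) →
                       (∀ e → f e ≈ potentialFlow p e + h e) →
                       energy f ≈ potentialEnergy p + 2# * Σ (λ e → drop p e * h e) + energy h
    energy-expansion p h f r≉0 f≈g+h = begin
      Σ (λ e → r e * f e ²)                                   ≈⟨ Σ-cong expand ⟩
      Σ (λ e → D e * g e + 2# * (D e * h e) + r e * h e ²)
        ≈⟨ Σ-distrib-+ (λ e → D e * g e + 2# * (D e * h e)) (λ e → r e * h e ²) ⟩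
      Σ (λ e → D e * g e + 2# * (D e * h e)) + energy h
        ≈⟨ +-congʳ (Σ-distrib-+ (λ e → D e * g e) (λ e → 2# * (D e * h e))) ⟩
      potentialEnergy p + Σ (λ e → 2# * (D e * h e)) + energy h
        ≈⟨ +-congʳ (+-congˡ (*-distribˡ-Σ 2# (λ e → D e * h e))) ⟨
      potentialEnergy p + 2# * Σ (λ e → D e * h e) + energy h ∎
      where
      D g : Fin m → Carrier
      D = drop p
      g = potentialFlow p
      expand : ∀ e → r e * f e ² ≈ D e * g e + 2# * (D e * h e) + r e * h e ²
      expand e = begin
        r e * f e ²
          ≈⟨ *-congˡ (*-cong (f≈g+h e) (f≈g+h e)) ⟩
        r e * (g e + h e) ²
          ≈⟨ solve 3 (λ r g h → r :* ((g :+ h) :* (g :+ h))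
                                := (r :* g) :* g :+ con (+ 2) :* ((r :* g) :* h) :+ r :* (h :* h))
                     refl (r e) (g e) (h e) ⟩
        (r e * g e) * g e + 2# * ((r e * g e) * h e) + r e * h e ²
          ≈⟨ +-congʳ (+-cong (*-congʳ rg≈D) (*-congˡ (*-congʳ rg≈D))) ⟩
        D e * g e + 2# * (D e * h e) + r e * h e ² ∎
        where
        rg≈D : r e * g e ≈ D e
        rg≈D = r*potentialFlow≈drop p e (r≉0 e)

    outflow≈ : ∀ p (V : VSet n) e →
               outflow p V e ≈ potentialFlow p e * (𝟙 (V (tail e)) - 𝟙 (V (head e)))
    outflow≈ p V e with V (tail e) | V (head e)
    ... | true  | false = solve 1 (λ g → g := g :* (con (+ 1) :- con (+ 0))) refl (potentialFlow p e)
    ... | false | true  = solve 3 (λ pt ph r⁻¹ → (ph :- pt) :* r⁻¹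
                                               := (pt :- ph) :* r⁻¹ :* (con (+ 0) :- con (+ 1)))
                                refl (p (tail e)) (p (head e)) (r e ⁻¹)
    ... | true  | true  = solve 1 (λ g → con (+ 0) := g :* (con (+ 1) :- con (+ 1))) refl (potentialFlow p e)
    ... | false | false = solve 1 (λ g → con (+ 0) := g :* (con (+ 0) :- con (+ 0))) refl (potentialFlow p e)

    cutPotential : (Fin m → Carrier) → (Fin m → VSet n) → Fin n → Carrier
    cutPotential w C v = Σ (λ e → w e * 𝟙 (C e v))

    Σ-*S : ∀ (w : Fin m → Carrier) C b →
           Σ (λ e → w e * S b (C e)) ≈ Σ (λ v → b v * cutPotential w C v)
    Σ-*S w C b = begin
      Σ (λ e → w e * S b (C e))
        ≈⟨ Σ-cong (λ e → *-distribˡ-Σ (w e) (λ v → [ C e v ]· b v)) ⟩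
      Σ (λ e → Σ (λ v → w e * [ C e v ]· b v))
        ≈⟨ Σ-cong (λ e → Σ-cong (λ v → rearrange e v)) ⟩
      Σ (λ e → Σ (λ v → b v * (w e * 𝟙 (C e v))))
        ≈⟨ Σ-comm (λ e v → b v * (w e * 𝟙 (C e v))) ⟩
      Σ (λ v → Σ (λ e → b v * (w e * 𝟙 (C e v))))
        ≈⟨ Σ-cong (λ v → *-distribˡ-Σ (b v) (λ e → w e * 𝟙 (C e v))) ⟨
      Σ (λ v → b v * cutPotential w C v) ∎
      where
      rearrange : ∀ e v → w e * [ C e v ]· b v ≈ b v * (w e * 𝟙 (C e v))
      rearrange e v = trans (*-congˡ ([]·≈𝟙* (C e v) (b v)))
        (solve 3 (λ w i b → w :* (i :* b) := b :* (w :* i)) refl (w e) (𝟙 (C e v)) (b v))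

    Σ-*fC : ∀ (w : Fin m → Carrier) C p →
            Σ (λ e → w e * fC p (C e))
              ≈ Σ (λ e → potentialFlow p e * (cutPotential w C (tail e) - cutPotential w C (head e)))
    Σ-*fC w C p = begin
      Σ (λ e → w e * fC p (C e))
        ≈⟨ Σ-cong (λ e → *-distribˡ-Σ (w e) (outflow p (C e))) ⟩
      Σ (λ e → Σ (λ e′ → w e * outflow p (C e) e′))
        ≈⟨ Σ-cong (λ e → Σ-cong (λ e′ → rearrange e e′)) ⟩
      Σ (λ e → Σ (λ e′ → g e′ * (X e e′ - Y e e′)))
        ≈⟨ Σ-comm (λ e e′ → g e′ * (X e e′ - Y e e′)) ⟩
      Σ (λ e′ → Σ (λ e → g e′ * (X e e′ - Y e e′)))
        ≈⟨ Σ-cong (λ e′ → *-distribˡ-Σ (g e′) (λ e → X e e′ - Y e e′)) ⟨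
      Σ (λ e′ → g e′ * Σ (λ e → X e e′ - Y e e′))
        ≈⟨ Σ-cong (λ e′ → *-congˡ (Σ-distrib-- (λ e → X e e′) (λ e → Y e e′))) ⟩
      Σ (λ e′ → g e′ * (cutPotential w C (tail e′) - cutPotential w C (head e′))) ∎
      where
      g : Fin m → Carrier
      g = potentialFlow p
      X Y : Fin m → Fin m → Carrier
      X e e′ = w e * 𝟙 (C e (tail e′))
      Y e e′ = w e * 𝟙 (C e (head e′))
      rearrange : ∀ e e′ → w e * outflow p (C e) e′ ≈ g e′ * (X e e′ - Y e e′)
      rearrange e e′ = trans (*-congˡ (outflow≈ p (C e) e′))
        (solve 4 (λ w g i j → w :* (g :* (i :- j)) := g :* (w :* i :- w :* j))
               refl (w e) (g e′) (𝟙 (C e (tail e′))) (𝟙 (C e (head e′))))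

    cutImbalance : (Fin n → Carrier) → (Fin n → Carrier) → VSet n → Carrier
    cutImbalance b p V = S b V - fC p V

    R≉0 : (∀ e → 0# < r e) → ∀ V e → crosses V e ≡ true → ¬ R V ≈ 0#
    R≉0 r>0 V e e-crosses = x≉0⇒x⁻¹≉0 (x>0⇒x≉0 (Σ-pos _ nonneg e pos))
      where
      1/r>0 : ∀ e → 0# < 1# / r e
      1/r>0 e = <-respʳ-≈ (sym (*-identityˡ _)) (x>0⇒x⁻¹>0 (r>0 e))
      nonneg : ∀ e′ → 0# ≤ [ crosses V e′ ]· (1# / r e′)
      nonneg e′ = []·-nonneg (crosses V e′) (inj₁ (1/r>0 e′))
      pos : 0# < [ crosses V e ]· (1# / r e)
      pos rewrite e-crosses = 1/r>0 e

    Δ²/R²≈cutImbalance² : ∀ b p V → ¬ R V ≈ 0# → Δ b p V ² / R V ² ≈ cutImbalance b p V ²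
    Δ²/R²≈cutImbalance² b p V R≉0 = begin
      (h * ρ) ² * (ρ ²) ⁻¹    ≈⟨ solve 3 (λ h ρ q → (h :* ρ) :* (h :* ρ) :* q := h :* h :* (ρ :* ρ :* q))
                                        refl h ρ ((ρ ²) ⁻¹) ⟩
      h ² * (ρ ² * (ρ ²) ⁻¹)  ≈⟨ *-congˡ (⁻¹-inverseʳ (x≉0⇒x²≉0 R≉0)) ⟩
      h ² * 1#                ≈⟨ *-identityʳ _ ⟩
      h ²                     ∎
      where
      h ρ : Carrier
      h = cutImbalance b p V
      ρ = R V

    module SpanningTreeFlow (T : EdgeSet m) (tree : SpanningTree G T)
                            (C : Fin m → VSet n) (components : IsComponentFamily G T C) where

      tail∈C : ∀ e → T e ≡ true → C e (tail e) ≡ true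
      tail∈C e e∈T = Equivalence.from (components e e∈T (tail e)) here

      head∉C : ∀ e → T e ≡ true → C e (head e) ≡ false
      head∉C e e∈T with C e (head e) in head∈C
      ... | false = ≡.refl
      ... | true  = ⊥-elim (proj₂ tree e e∈T (Equivalence.to (components e e∈T (head e)) head∈C))

      C-crossed-by-own-edge : ∀ e → T e ≡ true → crosses (C e) e ≡ true
      C-crossed-by-own-edge e e∈T = ≡.cong₂ _xor_ (tail∈C e e∈T) (head∉C e e∈T)

      C-not-crossed-by-other-edge : ∀ e e′ → T e ≡ true → T e′ ≡ true → e ≢ e′ →
                                    C e (tail e′) ≡ C e (head e′)
      C-not-crossed-by-other-edge e e′ e∈T e′∈T e≢e′ =
        true⇔true⇒≡ (λ tail∈C → from (head e′) (fwd e′ e′∈T-e (to (tail e′) tail∈C)))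
                    (λ head∈C → from (tail e′) (bwd e′ e′∈T-e (to (head e′) head∈C)))
        where
        to : ∀ v → C e v ≡ true → Reach G (_－_ G T e) (tail e) v
        to v = Equivalence.to (components e e∈T v)
        from : ∀ v → Reach G (_－_ G T e) (tail e) v → C e v ≡ true
        from v = Equivalence.from (components e e∈T v)
        e′∈T-e : _－_ G T e e′ ≡ true
        e′∈T-e with e ≟ e′
        ... | yes e≡e′ = ⊥-elim (e≢e′ e≡e′)
        ... | no  _    = e′∈T

      treePotential : (Fin m → Carrier) → Fin n → Carrier
      treePotential x = cutPotential (λ e → 𝟙 (T e) * x e) C

      treePotential-drop : ∀ x e₀ → T e₀ ≡ true →
                           treePotential x (tail e₀) - treePotential x (head e₀) ≈ x e₀
      treePotential-drop x e₀ e₀∈T = begin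
        treePotential x (tail e₀) - treePotential x (head e₀)
          ≈⟨ Σ-distrib-- (λ e → w e * 𝟙 (C e (tail e₀))) (λ e → w e * 𝟙 (C e (head e₀))) ⟨
        Σ (λ e → w e * 𝟙 (C e (tail e₀)) - w e * 𝟙 (C e (head e₀)))
          ≈⟨ Σ-concentrated _ e₀ other-edge ⟩
        w e₀ * 𝟙 (C e₀ (tail e₀)) - w e₀ * 𝟙 (C e₀ (head e₀))
          ≈⟨ own-edge ⟩
        x e₀ ∎
        where
        w : Fin m → Carrier
        w e = 𝟙 (T e) * x e
        other-edge : ∀ e → e ≢ e₀ → w e * 𝟙 (C e (tail e₀)) - w e * 𝟙 (C e (head e₀)) ≈ 0#
        other-edge e e≢e₀ with T e in e∈T
        ... | false = solve 3 (λ x i j → con (+ 0) :* x :* i :- con (+ 0) :* x :* j := con (+ 0))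
                            refl (x e) (𝟙 (C e (tail e₀))) (𝟙 (C e (head e₀)))
        ... | true rewrite C-not-crossed-by-other-edge e e₀ e∈T e₀∈T e≢e₀ = -‿inverseʳ _
        own-edge : w e₀ * 𝟙 (C e₀ (tail e₀)) - w e₀ * 𝟙 (C e₀ (head e₀)) ≈ x e₀
        own-edge rewrite e₀∈T | tail∈C e₀ e₀∈T | head∉C e₀ e₀∈T =
          solve 1 (λ x → con (+ 1) :* x :* con (+ 1) :- con (+ 1) :* x :* con (+ 0) := x) refl (x e₀)

      treePotential-differences : ∀ p u v →
                                  treePotential (drop p) u - treePotential (drop p) v ≈ p u - p v
      treePotential-differences p u v = difference-swap (Reach-invariant ψ ψ-edge (proj₁ tree u v))
        where
        ψ : Fin n → Carrier
        ψ v = treePotential (drop p) v - p v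
        ψ-edge : ∀ e → T e ≡ true → ψ (tail e) ≈ ψ (head e)
        ψ-edge e e∈T = difference-swap (treePotential-drop (drop p) e e∈T)

      correction : (p b : Fin n → Carrier) → Fin m → Carrier
      correction p b e = 𝟙 (T e) * cutImbalance b p (C e)

      treeFlow≈potentialFlow+correction : ∀ p b e →
                                          treeFlow T C p b e ≈ potentialFlow p e + correction p b e
      treeFlow≈potentialFlow+correction p b e with T e in e∈T
      ... | false = solve 2 (λ g h → g := g :+ con (+ 0) :* h) refl (potentialFlow p e) (cutImbalance b p (C e))
      ... | true  = begin
        S b (C e) - others
          ≈⟨ solve 3 (λ s σ g → s :- σ := g :+ con (+ 1) :* (s :- (σ :+ g))) refl (S b (C e)) others g ⟩
        g + 1# * (S b (C e) - (others + g))
          ≈⟨ +-congˡ (*-congˡ (+-congˡ (-‿cong (sym fC≈others+g)))) ⟩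
        g + 1# * cutImbalance b p (C e) ∎
        where
        g others : Carrier
        g      = potentialFlow p e
        others = Σ (λ e′ → [ not ⌊ e ≟ e′ ⌋ ]· outflow p (C e) e′)
        own-outflow : outflow p (C e) e ≈ g
        own-outflow rewrite tail∈C e e∈T | head∉C e e∈T = refl
        fC≈others+g : fC p (C e) ≈ others + g
        fC≈others+g = trans (Σ-split (outflow p (C e)) e) (+-congˡ own-outflow)

      Σ-drop*correction : ∀ p b → Σ b ≈ 0# →
                          Σ (λ e → drop p e * correction p b e) ≈ Σ (λ v → b v * p v) - potentialEnergy p
      Σ-drop*correction p b Σb≈0 = begin
        Σ (λ e → drop p e * correction p b e)
          ≈⟨ Σ-cong (λ e → solve 4 (λ d t s f → d :* (t :* (s :- f)) := t :* d :* s :- t :* d :* f)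
                                   refl (drop p e) (𝟙 (T e)) (S b (C e)) (fC p (C e))) ⟩
        Σ (λ e → w e * S b (C e) - w e * fC p (C e))
          ≈⟨ Σ-distrib-- (λ e → w e * S b (C e)) (λ e → w e * fC p (C e)) ⟩
        Σ (λ e → w e * S b (C e)) - Σ (λ e → w e * fC p (C e))
          ≈⟨ +-cong (Σ-*S w C b) (-‿cong (Σ-*fC w C p)) ⟩
        Σ (λ v → b v * φ v) - Σ (λ e → potentialFlow p e * (φ (tail e) - φ (head e)))
          ≈⟨ +-cong (Σ-*-shift-invariant b φ p Σb≈0 (treePotential-differences p))
                    (-‿cong (Σ-cong (λ e → trans (*-congˡ (treePotential-differences p (tail e) (head e)))
                                                 (*-comm _ _)))) ⟩
        Σ (λ v → b v * p v) - potentialEnergy p ∎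
        where
        w : Fin m → Carrier
        w e = 𝟙 (T e) * drop p e
        φ : Fin n → Carrier
        φ = treePotential (drop p)

      summand≈r*correction² : (∀ e → 0# < r e) → ∀ p b e →
                              [ T e ]· (r e * (Δ b p (C e) ² / R (C e) ²)) ≈ r e * correction p b e ²
      summand≈r*correction² r>0 p b e with T e in e∈T
      ... | false = solve 2 (λ r h → con (+ 0) := r :* ((con (+ 0) :* h) :* (con (+ 0) :* h)))
                          refl (r e) (cutImbalance b p (C e))
      ... | true  = trans (*-congˡ (Δ²/R²≈cutImbalance² b p (C e) R[C]≉0))
                          (solve 2 (λ r h → r :* (h :* h) := r :* ((con (+ 1) :* h) :* (con (+ 1) :* h)))
                                 refl (r e) (cutImbalance b p (C e)))
        where
        R[C]≉0 : ¬ R (C e) ≈ 0#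
        R[C]≉0 = R≉0 r>0 (C e) e (C-crossed-by-own-edge e e∈T)

lemma3 : ∀ {c ℓ : Level} (F : OrderedField c ℓ) {n m : ℕ} (G : Graph n m)
             (r : Fin m → OrderedField.Carrier F) →
             let open OrderedField F
                 open Electrical F G r
             in Simple G → Connected G (AllEdges G) →
                (∀ e → 0# < r e) →
                (T : EdgeSet m) → SpanningTree G T →
                (C : Fin m → VSet n) → IsComponentFamily G T C →
                (p b : Fin n → Carrier) → Σ b ≈ 0# →
                gap b (treeFlow T C p b) p
                  ≈ Σ (λ e → [ T e ]· (r e * ((Δ b p (C e)) ² / (R (C e)) ²)))
lemma3 F {m = m} G r _ _ r>0 T tree C components p b Σb≈0 = begin
  energy (treeFlow T C p b) - (2# * bᵀp - Σ (λ u → Σ (λ v → p u * L u v * p v)))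
    ≈⟨ +-cong (energy-expansion p h (treeFlow T C p b) (x>0⇒x≉0 ∘ r>0)
                                (treeFlow≈potentialFlow+correction p b))
              (-‿cong (+-congˡ (-‿cong (Laplacian-quadratic-form p)))) ⟩
  pᵀLp + 2# * Σ (λ e → drop p e * h e) + energy h - (2# * bᵀp - pᵀLp)
    ≈⟨ +-congʳ (+-congʳ (+-congˡ (*-congˡ (Σ-drop*correction p b Σb≈0)))) ⟩
  pᵀLp + 2# * (bᵀp - pᵀLp) + energy h - (2# * bᵀp - pᵀLp)
    ≈⟨ solve 3 (λ q x e → q :+ con (+ 2) :* (x :- q) :+ e :- (con (+ 2) :* x :- q) := e)
               refl pᵀLp bᵀp (energy h) ⟩
  energy h
    ≈⟨ Σ-cong (summand≈r*correction² r>0 p b) ⟨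
  Σ (λ e → [ T e ]· (r e * (Δ b p (C e) ² / R (C e) ²))) ∎
  where
  open OrderedField F
  open Electrical F G r
  open OrderedFieldProperties F
  open Network G r
  open SpanningTreeFlow T tree C components
  bᵀp pᵀLp : Carrier
  bᵀp  = Σ (λ i → b i * p i)
  pᵀLp = potentialEnergy p
  h : Fin m → Carrier
  h = correction p b
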